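{- Let $\Gamma\subseteq\{\mathsf T,\mathsf 4,\mathsf B,\mathsf 5,\mathsf{.2}\}$. Then $\mathcal L(\Gamma)$ has the Craig interpolation property: for all pairwise disjoint sets of propositional letters $\overline p,\overline q,\overline r$, and all $\phi\in Fm_{\overline p\cup\overline q}$, $\psi\in Fm_{\overline p\cup\overline r}$ with $\phi\trianglelefteq\psi\in\mathcal L(\Gamma)$, there is $\chi\in Fm_{\overline p}$ with $\phi\trianglelefteq\chi\in\mathcal L(\Gamma)$ and $\chi\trianglelefteq\psi\in\mathcal L(\Gamma)$.
   Context: $Fm_P$ is the set of formulas generated by $p\mid\top\mid\bot\mid\phi\wedge\psi\mid\phi\vee\psi\mid\Box\phi\mid\Diamond\phi$ with $p\in P$; a consequence pair is an expression $\phi\trianglelefteq\psi$. The axioms are: $\mathsf T$ = $\{\Box p\trianglelefteq p,\ p\trianglelefteq\Diamond p\}$; $\mathsf 4$ = $\{\Box p\trianglelefteq\Box\Box p,\ \Diamond\Diamond p\trianglelefteq\Diamond p\}$; $\mathsf B$ = $\{p\trianglelefteq\Box\Diamond p,\ \Diamond\Box p\trianglelefteq p\}$; $\mathsf 5$ = $\{\Diamond p\trianglelefteq\Box\Diamond p,\ \Diamond\Box p\trianglelefteq\Box p\}$; $\mathsf{.2}$ = $\{\Diamond\Box p\trianglelefteq\Box\Diamond p\}$. $\mathcal L(\Gamma)$ is the smallest set of consequence pairs containing the pairs of the axioms in $\Gamma$, closed under uniform substitution, containing $p\trianglelefteq\top$, $\bot\trianglelefteq p$, $p\trianglelefteq p$,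 $p\wedge q\trianglelefteq p$, $p\wedge q\trianglelefteq q$, $p\trianglelefteq p\vee q$, $q\trianglelefteq p\vee q$, $\top\trianglelefteq\Box\top$, $\top\trianglelefteq\Diamond\top$, $\Box p\wedge\Box q\trianglelefteq\Box(p\wedge q)$, $\Diamond p\wedge\Box q\trianglelefteq\Diamond(p\wedge q)$, and closed under the rules: from $p\trianglelefteq q$, $q\trianglelefteq r$ infer $p\trianglelefteq r$; from $p\trianglelefteq q$, $p\trianglelefteq r$ infer $p\trianglelefteq q\wedge r$; from $p\trianglelefteq r$, $q\trianglelefteq r$ infer $p\vee q\trianglelefteq r$; from $p\trianglelefteq q$ infer $\Box p\trianglelefteq\Box q$ and $\Diamond p\trianglelefteq\Diamond q$. -}

module Defs where

open import Data.Nat using (ℕ)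
open import Data.Unit using (⊤)
open import Data.Product using (_×_)
open import Data.Sum using (_⊎_)
open import Data.Empty using (⊥)
open import Relation.Nullary using (¬_)

Letter : Set
Letter = ℕ

data Fm : Set where
  var  : Letter → Fm
  ⊤'   : Fm
  ⊥'   : Fm
  _∧'_ : Fm → Fm → Fm
  _∨'_ : Fm → Fm → Fm
  □_   : Fm → Fm
  ◇_   : Fm → Fm

infixr 6 _∧'_
infixr 5 _∨'_
infix 7 □_ ◇_

LetterSet : Set₁
LetterSet = Letter → Set

InFm : LetterSet → Fm → Set
InFm P (var x)   = P x
InFm P ⊤'        = ⊤
InFm P ⊥'        = ⊤
InFm P (φ ∧' ψ)  = InFm P φ × InFm P ψ
InFm P (φ ∨' ψ)  = InFm P φ × InFm P ψ
InFm P (□ φ)     = InFm P φ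
InFm P (◇ φ)     = InFm P φ

_∪_ : LetterSet → LetterSet → LetterSet
(P ∪ Q) x = P x ⊎ Q x

Disjoint : LetterSet → LetterSet → Set
Disjoint P Q = ∀ x → P x → Q x → ⊥

Subst : Set
Subst = Letter → Fm

_[_] : Fm → Subst → Fm
var x    [ σ ] = σ x
⊤'       [ σ ] = ⊤'
⊥'       [ σ ] = ⊥'
(φ ∧' ψ) [ σ ] = (φ [ σ ]) ∧' (ψ [ σ ])
(φ ∨' ψ) [ σ ] = (φ [ σ ]) ∨' (ψ [ σ ])
(□ φ)    [ σ ] = □ (φ [ σ ])
(◇ φ)    [ σ ] = ◇ (φ [ σ ])

data Axiom : Set where
  axT ax4 axB ax5 ax2 : Axiom

AxiomSet : Set₁
AxiomSet = Axiom → Set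

p q r : Fm
p = var 0
q = var 1
r = var 2

data AxPair : Axiom → Fm → Fm → Set where
  T₁ : AxPair axT (□ p) p
  T₂ : AxPair axT p (◇ p)
  4₁ : AxPair ax4 (□ p) (□ □ p)
  4₂ : AxPair ax4 (◇ ◇ p) (◇ p)
  B₁ : AxPair axB p (□ ◇ p)
  B₂ : AxPair axB (◇ □ p) p
  5₁ : AxPair ax5 (◇ p) (□ ◇ p)
  5₂ : AxPair ax5 (◇ □ p) (□ p)
  D₂ : AxPair ax2 (◇ □ p) (□ ◇ p)

infix 4 _⊢_⊴_
data _⊢_⊴_ (Γ : AxiomSet) : Fm → Fm → Set where
  ax     : ∀ {a φ ψ} → Γ a → AxPair a φ ψ → Γ ⊢ φ ⊴ ψ
  usubst : ∀ {φ ψ} (σ : Subst) → Γ ⊢ φ ⊴ ψ → Γ ⊢ φ [ σ ] ⊴ ψ [ σ ]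
  top    : Γ ⊢ p ⊴ ⊤'
  bot    : Γ ⊢ ⊥' ⊴ p
  refl'  : Γ ⊢ p ⊴ p
  ∧-e₁   : Γ ⊢ p ∧' q ⊴ p
  ∧-e₂   : Γ ⊢ p ∧' q ⊴ q
  ∨-i₁   : Γ ⊢ p ⊴ p ∨' q
  ∨-i₂   : Γ ⊢ q ⊴ p ∨' q
  □⊤     : Γ ⊢ ⊤' ⊴ □ ⊤'
  ◇⊤     : Γ ⊢ ⊤' ⊴ ◇ ⊤'
  □∧     : Γ ⊢ (□ p) ∧' (□ q) ⊴ □ (p ∧' q)
  ◇□∧    : Γ ⊢ (◇ p) ∧' (□ q) ⊴ ◇ (p ∧' q)
  cut    : ∀ {φ ψ θ} → Γ ⊢ φ ⊴ ψ → Γ ⊢ ψ ⊴ θ → Γ ⊢ φ ⊴ θ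
  ∧-i    : ∀ {φ ψ θ} → Γ ⊢ φ ⊴ ψ → Γ ⊢ φ ⊴ θ → Γ ⊢ φ ⊴ ψ ∧' θ
  ∨-e    : ∀ {φ ψ θ} → Γ ⊢ φ ⊴ θ → Γ ⊢ ψ ⊴ θ → Γ ⊢ φ ∨' ψ ⊴ θ
  □-mon  : ∀ {φ ψ} → Γ ⊢ φ ⊴ ψ → Γ ⊢ □ φ ⊴ □ ψ
  ◇-mon  : ∀ {φ ψ} → Γ ⊢ φ ⊴ ψ → Γ ⊢ ◇ φ ⊴ ◇ ψ

{-# OPTIONS --safe #-}
-- Positive formulas are monotone in their letters, so replacing the letters of φ
-- that lie outside P by ⊤ only weakens φ.  Applying the same substitution to the
-- derivation of φ ⊴ ψ leaves ψ untouched, because ψ has no such letters; the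
-- substituted φ is therefore an interpolant.
module Submission where

open import Defs
open import Data.Product using (Σ; _×_; _,_)
open import Data.Sum using (inj₁; inj₂; map₂; [_,_]′)
open import Data.Unit using (tt)
open import Data.Empty using (⊥-elim)
open import Data.Nat using (_≟_)
open import Data.List using (List; []; _∷_; _++_)
open import Data.List.Membership.DecPropositional _≟_ using (_∈_; _∈?_)
open import Data.List.Membership.Propositional.Properties using (∈-++⁺ˡ; ∈-++⁺ʳ; ∈-++⁻)
open import Data.List.Relation.Unary.Any using (here)
open import Relation.Nullary using (¬_; yes; no)
open import Relation.Unary using (Decidable)
open import Relation.Binary.PropositionalEquality using (_≡_; refl; cong; cong₂; trans; subst)

module _ {Γ : AxiomSet} where

  ⊴-refl : ∀ {φ} → Γ ⊢ φ ⊴ φ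
  ⊴-refl {φ} = usubst (λ _ → φ) refl'

  ⊴-⊤ : ∀ {φ} → Γ ⊢ φ ⊴ ⊤'
  ⊴-⊤ {φ} = usubst (λ _ → φ) top

  private
    p,q≔ : Fm → Fm → Subst
    p,q≔ a b 0 = a
    p,q≔ a b _ = b

  ∧-mono : ∀ {a b c d} → Γ ⊢ a ⊴ c → Γ ⊢ b ⊴ d → Γ ⊢ a ∧' b ⊴ c ∧' d
  ∧-mono {a} {b} a⊴c b⊴d =
    ∧-i (cut (usubst (p,q≔ a b) ∧-e₁) a⊴c) (cut (usubst (p,q≔ a b) ∧-e₂) b⊴d)

  ∨-mono : ∀ {a b c d} → Γ ⊢ a ⊴ c → Γ ⊢ b ⊴ d → Γ ⊢ a ∨' b ⊴ c ∨' d
  ∨-mono {c = c} {d} a⊴c b⊴d =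
    ∨-e (cut a⊴c (usubst (p,q≔ c d) ∨-i₁)) (cut b⊴d (usubst (p,q≔ c d) ∨-i₂))

  []-mono : ∀ {σ τ} → (∀ x → Γ ⊢ σ x ⊴ τ x) → ∀ φ → Γ ⊢ φ [ σ ] ⊴ φ [ τ ]
  []-mono σ⊴τ (var x)  = σ⊴τ x
  []-mono σ⊴τ ⊤'       = ⊴-refl
  []-mono σ⊴τ ⊥'       = ⊴-refl
  []-mono σ⊴τ (a ∧' b) = ∧-mono ([]-mono σ⊴τ a) ([]-mono σ⊴τ b)
  []-mono σ⊴τ (a ∨' b) = ∨-mono ([]-mono σ⊴τ a) ([]-mono σ⊴τ b)
  []-mono σ⊴τ (□ a)    = □-mon ([]-mono σ⊴τ a)
  []-mono σ⊴τ (◇ a)    = ◇-mon ([]-mono σ⊴τ a)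

[]-identity : ∀ φ → φ [ var ] ≡ φ
[]-identity (var x)  = refl
[]-identity ⊤'       = refl
[]-identity ⊥'       = refl
[]-identity (a ∧' b) = cong₂ _∧'_ ([]-identity a) ([]-identity b)
[]-identity (a ∨' b) = cong₂ _∨'_ ([]-identity a) ([]-identity b)
[]-identity (□ a)    = cong □_ ([]-identity a)
[]-identity (◇ a)    = cong ◇_ ([]-identity a)

[]-cong : ∀ {A σ τ} → (∀ x → A x → σ x ≡ τ x) → ∀ φ → InFm A φ → φ [ σ ] ≡ φ [ τ ]
[]-cong σ≡τ (var x)  Ax       = σ≡τ x Ax
[]-cong σ≡τ ⊤'       _        = refl
[]-cong σ≡τ ⊥'       _        = refl
[]-cong σ≡τ (a ∧' b) (Aa , Ab) = cong₂ _∧'_ ([]-cong σ≡τ a Aa) ([]-cong σ≡τ b Ab)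
[]-cong σ≡τ (a ∨' b) (Aa , Ab) = cong₂ _∨'_ ([]-cong σ≡τ a Aa) ([]-cong σ≡τ b Ab)
[]-cong σ≡τ (□ a)    Aa       = cong □_ ([]-cong σ≡τ a Aa)
[]-cong σ≡τ (◇ a)    Aa       = cong ◇_ ([]-cong σ≡τ a Aa)

InFm-mono : ∀ {A B} → (∀ {x} → A x → B x) → ∀ φ → InFm A φ → InFm B φ
InFm-mono A⊆B (var x)  Ax        = A⊆B Ax
InFm-mono A⊆B ⊤'       _         = tt
InFm-mono A⊆B ⊥'       _         = tt
InFm-mono A⊆B (a ∧' b) (Aa , Ab) = InFm-mono A⊆B a Aa , InFm-mono A⊆B b Ab
InFm-mono A⊆B (a ∨' b) (Aa , Ab) = InFm-mono A⊆B a Aa , InFm-mono A⊆B b Ab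
InFm-mono A⊆B (□ a)    Aa        = InFm-mono A⊆B a Aa
InFm-mono A⊆B (◇ a)    Aa        = InFm-mono A⊆B a Aa

InFm-[] : ∀ {A B σ} → (∀ x → A x → InFm B (σ x)) → ∀ φ → InFm A φ → InFm B (φ [ σ ])
InFm-[] Bσ (var x)  Ax        = Bσ x Ax
InFm-[] Bσ ⊤'       _         = tt
InFm-[] Bσ ⊥'       _         = tt
InFm-[] Bσ (a ∧' b) (Aa , Ab) = InFm-[] Bσ a Aa , InFm-[] Bσ b Ab
InFm-[] Bσ (a ∨' b) (Aa , Ab) = InFm-[] Bσ a Aa , InFm-[] Bσ b Ab
InFm-[] Bσ (□ a)    Aa        = InFm-[] Bσ a Aa
InFm-[] Bσ (◇ a)    Aa        = InFm-[] Bσ a Aa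

module Erase {S : LetterSet} (S? : Decidable S) where

  erase : Subst
  erase x with S? x
  ... | yes _ = ⊤'
  ... | no  _ = var x

  var⊴erase : ∀ {Γ} x → Γ ⊢ var x ⊴ erase x
  var⊴erase x with S? x
  ... | yes _ = ⊴-⊤
  ... | no  _ = ⊴-refl

  erase-fixes : ∀ {x} → ¬ S x → erase x ≡ var x
  erase-fixes {x} x∉S with S? x
  ... | yes x∈S = ⊥-elim (x∉S x∈S)
  ... | no  _   = refl

  InFm-erase : ∀ {P} x → (P ∪ S) x → InFm P (erase x)
  InFm-erase x _ with S? x
  InFm-erase x _          | yes _   = tt
  InFm-erase x (inj₁ Px)  | no  _   = Px
  InFm-erase x (inj₂ Sx)  | no  x∉S = ⊥-elim (x∉S Sx)

  erasure-interpolates : ∀ {Γ P R φ ψ} → Disjoint P S → Disjoint R S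
    → InFm (P ∪ S) φ → InFm (P ∪ R) ψ → Γ ⊢ φ ⊴ ψ
    → InFm P (φ [ erase ]) × (Γ ⊢ φ ⊴ φ [ erase ]) × (Γ ⊢ φ [ erase ] ⊴ ψ)
  erasure-interpolates {Γ} {P} {R} {φ} {ψ} P∩S=∅ R∩S=∅ φ∈P∪S ψ∈P∪R φ⊴ψ =
    InFm-[] InFm-erase φ φ∈P∪S , φ⊴φ[erase] , cut (usubst erase φ⊴ψ) ψ[erase]⊴ψ
    where
      φ⊴φ[erase] : Γ ⊢ φ ⊴ φ [ erase ]
      φ⊴φ[erase] = subst (Γ ⊢_⊴ φ [ erase ]) ([]-identity φ) ([]-mono var⊴erase φ)

      erase-fixes-P∪R : ∀ x → (P ∪ R) x → erase x ≡ var x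
      erase-fixes-P∪R x (inj₁ Px) = erase-fixes (P∩S=∅ x Px)
      erase-fixes-P∪R x (inj₂ Rx) = erase-fixes (R∩S=∅ x Rx)

      ψ[erase]⊴ψ : Γ ⊢ ψ [ erase ] ⊴ ψ
      ψ[erase]⊴ψ = subst (Γ ⊢ ψ [ erase ] ⊴_) ψ[erase]≡ψ ⊴-refl
        where
          ψ[erase]≡ψ : ψ [ erase ] ≡ ψ
          ψ[erase]≡ψ = trans ([]-cong erase-fixes-P∪R ψ ψ∈P∪R) ([]-identity ψ)

module _ {P Q : LetterSet} where

  -- Q need not be decidable, so the Q-letters of φ are read off the proof of
  -- φ ∈ Fm_{P∪Q}; membership in this finite list is decidable.
  qLetters : ∀ φ → InFm (P ∪ Q) φ → List Letter
  qLetters (var x)  (inj₁ _)  = []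
  qLetters (var x)  (inj₂ _)  = x ∷ []
  qLetters ⊤'       _         = []
  qLetters ⊥'       _         = []
  qLetters (a ∧' b) (ha , hb) = qLetters a ha ++ qLetters b hb
  qLetters (a ∨' b) (ha , hb) = qLetters a ha ++ qLetters b hb
  qLetters (□ a)    ha        = qLetters a ha
  qLetters (◇ a)    ha        = qLetters a ha

  qLetters⊆Q : ∀ φ h {x} → x ∈ qLetters φ h → Q x
  qLetters⊆Q (var x)  (inj₂ Qx) (here refl) = Qx
  qLetters⊆Q (a ∧' b) (ha , hb) x∈ab =
    [ qLetters⊆Q a ha , qLetters⊆Q b hb ]′ (∈-++⁻ (qLetters a ha) x∈ab)
  qLetters⊆Q (a ∨' b) (ha , hb) x∈ab =
    [ qLetters⊆Q a ha , qLetters⊆Q b hb ]′ (∈-++⁻ (qLetters a ha) x∈ab)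
  qLetters⊆Q (□ a)    ha        x∈a  = qLetters⊆Q a ha x∈a
  qLetters⊆Q (◇ a)    ha        x∈a  = qLetters⊆Q a ha x∈a

  InFm-qLetters : ∀ φ h → InFm (P ∪ (_∈ qLetters φ h)) φ
  InFm-qLetters (var x)  (inj₁ Px)  = inj₁ Px
  InFm-qLetters (var x)  (inj₂ _)   = inj₂ (here refl)
  InFm-qLetters ⊤'       _          = tt
  InFm-qLetters ⊥'       _          = tt
  InFm-qLetters (a ∧' b) (ha , hb)  =
    InFm-mono (map₂ ∈-++⁺ˡ) a (InFm-qLetters a ha) ,
    InFm-mono (map₂ (∈-++⁺ʳ (qLetters a ha))) b (InFm-qLetters b hb)
  InFm-qLetters (a ∨' b) (ha , hb)  =
    InFm-mono (map₂ ∈-++⁺ˡ) a (InFm-qLetters a ha) ,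
    InFm-mono (map₂ (∈-++⁺ʳ (qLetters a ha))) b (InFm-qLetters b hb)
  InFm-qLetters (□ a)    ha         = InFm-qLetters a ha
  InFm-qLetters (◇ a)    ha         = InFm-qLetters a ha

corollary4p20 : (Γ : AxiomSet) (P Q R : LetterSet)
    → Disjoint P Q → Disjoint P R → Disjoint Q R
    → (φ ψ : Fm) → InFm (P ∪ Q) φ → InFm (P ∪ R) ψ
    → Γ ⊢ φ ⊴ ψ
    → Σ Fm (λ χ → InFm P χ × (Γ ⊢ φ ⊴ χ) × (Γ ⊢ χ ⊴ ψ))
corollary4p20 Γ P Q R P∩Q=∅ _ Q∩R=∅ φ ψ φ∈P∪Q ψ∈P∪R φ⊴ψ =
  φ [ erase ] , erasure-interpolates P∩S=∅ R∩S=∅ (InFm-qLetters φ φ∈P∪Q) ψ∈P∪R φ⊴ψ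
  where
    S : LetterSet
    S = _∈ qLetters φ φ∈P∪Q

    open Erase (_∈? qLetters φ φ∈P∪Q)

    P∩S=∅ : Disjoint P S
    P∩S=∅ x Px x∈S = P∩Q=∅ x Px (qLetters⊆Q φ φ∈P∪Q x∈S)

    R∩S=∅ : Disjoint R S
    R∩S=∅ x Rx x∈S = Q∩R=∅ x (qLetters⊆Q φ φ∈P∪Q x∈S) Rx
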